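{- Let $n$ be an even integer and $p$ a prime with $\gcd(n,p)=1$. Let $D$ denote the set of all positive divisors of $n$. The following conditions are equivalent: (i) $np$ is a half-Zumkeller number. (ii) $D$ can be partitioned into two disjoint parts $D_1$ and $D_2$ such that $n\in D_1$, $\frac n2\in D_2$, and $p\left(\sum_{d\in D_2} d-\sum_{d\in D_1} d\right)$ can be written as $\sum_{d\in S}d-\sum_{d\in D\setminus S}d$ for some subset $S\subseteq D$. (iii) $D$ can be partitioned into two disjoint parts $D_1$ and $D_2$ such that $n\in D_1$, $\frac n2\in D_2$, and $\frac{(p+1)\left(\sum_{d\in D_2} d-\sum_{d\in D_1} d\right)}{2}$ can be written as $\sum_{d\in S}d-\sum_{d\in T}d$ for some subsets $S\subseteq D_2$ and $T\subseteq D_1$. (iv) $D$ can be partitioned into four disjoint parts $A_1,A_2,A_3,A_4$ such that $n\in A_3\cup A_4$, $\frac n2\in A_1\cup A_2$, and $$(p+1)\sum_{d\in A_1} d+(p-1)\sum_{d\in A_2} d=(p+1)\sum_{d\in A_3} d+(p-1)\sum_{d\in A_4} d.$$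
   Context: A positive integer $m$ is a half-Zumkeller number if the set of all positive divisors of $m$ other than $m$ itself can be partitioned into two disjoint parts whose sums are equal. Parts of partitions may be empty; an empty sum is $0$. -}

module Defs where

open import Data.Bool using (Bool; true; false; not)
open import Data.Nat using (ℕ; suc; _+_; _*_; _∸_; _/_; _≟_)
open import Data.Nat.Divisibility using (_∣?_)
open import Data.Fin using (Fin)
import Data.Fin as Fin
open import Data.List using (List; filter; filterᵇ; applyUpTo)
open import Data.Nat.ListAction using (sum)
open import Data.Product using (_×_; ∃-syntax)
open import Data.Sum using (_⊎_)
open import Data.Integer using (ℤ; +_) renaming (_*_ to _*ℤ_; _-_ to _-ℤ_)
open import Relation.Nullary using (¬?)
open import Relation.Nullary.Decidable using (⌊_⌋)
open import Relation.Binary.PropositionalEquality using (_≡_)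

divisors : ℕ → List ℕ
divisors n = filter (_∣? n) (applyUpTo suc n)

properDivisors : ℕ → List ℕ
properDivisors m = filter (λ d → ¬? (d ≟ m)) (divisors m)

-- A subset of a (duplicate-free) list xs is given by a characteristic function
-- f : ℕ → Bool; the subset is  filterᵇ f xs , its complement  filterᵇ (not ∘ f) xs.
-- So a function f encodes a partition of xs into two disjoint parts.
Σ⟨_⟩ : (ℕ → Bool) → List ℕ → ℕ
Σ⟨ f ⟩ xs = sum (filterᵇ f xs)

Σ⟨¬_⟩ : (ℕ → Bool) → List ℕ → ℕ
Σ⟨¬ f ⟩ xs = sum (filterᵇ (λ d → not (f d)) xs)

HalfZumkeller : ℕ → Set
HalfZumkeller m = ∃[ f ] (Σ⟨ f ⟩ (properDivisors m) ≡ Σ⟨¬ f ⟩ (properDivisors m))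

-- Condition (ii).  D₁ = {d ∈ D ∣ f d = true}, D₂ = {d ∈ D ∣ f d = false},
-- S = {d ∈ D ∣ s d = true}.
Cond2 : ℕ → ℕ → Set
Cond2 n p =
  ∃[ f ] (f n ≡ true × f (n / 2) ≡ false ×
    ∃[ s ] ((+ p) *ℤ ((+ Σ⟨¬ f ⟩ D) -ℤ (+ Σ⟨ f ⟩ D))
              ≡ (+ Σ⟨ s ⟩ D) -ℤ (+ Σ⟨¬ s ⟩ D)))
  where D = divisors n

-- Condition (iii).  S = {d ∈ D₂ ∣ s d = true} ⊆ D₂, T = {d ∈ D₁ ∣ t d = true} ⊆ D₁.
-- The equation  (p+1)(ΣD₂ - ΣD₁)/2 = ΣS - ΣT  is written (over ℤ) as
-- 2·(ΣS - ΣT) = (p+1)(ΣD₂ - ΣD₁).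
Cond3 : ℕ → ℕ → Set
Cond3 n p =
  ∃[ f ] (f n ≡ true × f (n / 2) ≡ false ×
    ∃[ s ] ∃[ t ]
      ((+ 2) *ℤ ((+ sum (filterᵇ s (filterᵇ (λ d → not (f d)) D)))
                  -ℤ (+ sum (filterᵇ t (filterᵇ f D))))
        ≡ (+ (p + 1)) *ℤ ((+ Σ⟨¬ f ⟩ D) -ℤ (+ Σ⟨ f ⟩ D))))
  where D = divisors n

-- Condition (iv).  c : ℕ → Fin 4 assigns each divisor to a part;
-- A₁,A₂,A₃,A₄ are the parts with labels 0,1,2,3.
part : (ℕ → Fin 4) → Fin 4 → List ℕ → ℕ
part c i xs = sum (filterᵇ (λ d → ⌊ c d Fin.≟ i ⌋) xs)

Cond4 : ℕ → ℕ → Set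
Cond4 n p =
  ∃[ c ] ((c n ≡ Fin.fromℕ 3 ⊎ c n ≡ Fin.suc (Fin.suc Fin.zero)) ×
          (c (n / 2) ≡ Fin.zero ⊎ c (n / 2) ≡ Fin.suc Fin.zero) ×
          ((p + 1) * part c Fin.zero D + (p ∸ 1) * part c (Fin.suc Fin.zero) D
            ≡ (p + 1) * part c (Fin.suc (Fin.suc Fin.zero)) D + (p ∸ 1) * part c (Fin.fromℕ 3) D))
  where D = divisors n

module Submission where

-- Every condition is read as the vanishing of an integer-weighted sum over a
-- list of divisors.  A partition into two parts, given by f : ℕ → Bool, is a
-- signing σ f d = ±d, and "the parts have equal sums" says Σ σ f = 0.  The
-- conditions (iii) and (iv) concern labellings c of D by the four classes
-- A₁,…,A₄; with the class coefficients −(p+1), 1−p, p+1, p−1 both equations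
-- say  Σ_{d∈D} κ (c d)·d = 0, and (ii) is the labelling with T = D₁ ∖ S.  So
-- (ii) ⇔ (iii) ⇔ (iv) is a translation of witnesses, valid for all n and p.
-- The arithmetic lies in (i) ⇔ (ii): as p is prime and coprime to n, the
-- divisors of n·p are D together with p·D, so a signing of the proper
-- divisors of n·p is a signing s of D plus p times a signing of D ∖ {n}.
-- Arranging (n/2)·p to be positive, one exchange step moves n to the plus
-- side and n/2 to the minus side, which gives the signing f of (ii).

open import Data.Bool using (Bool; true; false; not; _∧_; if_then_else_)
open import Data.Nat using (ℕ; suc; _+_; _*_; _∸_; _/_; _≟_; NonZero; ≢-nonZero⁻¹)
import Data.Nat.Properties as ℕ
open import Data.Nat.ListAction using (sum)
open import Data.Nat.Divisibility
  using (_∣_; _∣?_; divides; ∣-refl; ∣-trans; ∣⇒≤; 0∣⇒≡0; _∣0; ∣m⇒∣m*n; n∣m*n; *-monoˡ-∣;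
         *-cancelʳ-∣; m/n∣m)
open import Data.Nat.DivMod using (m*n/n≡m; m/n<m)
open import Data.Nat.GCD using (gcd)
open import Data.Nat.Coprimality using (Coprime; gcd≡1⇒coprime; coprime-divisor)
open import Data.Nat.Primality using (Prime; prime⇒irreducible; prime⇒nonZero; ¬prime[1])
open import Data.Integer using (ℤ; +_; -_; 0ℤ; 1ℤ; -1ℤ)
  renaming (_+_ to _+ℤ_; _*_ to _*ℤ_; _-_ to _-ℤ_)
import Data.Integer.Properties as ℤ
open import Data.Integer.Tactic.RingSolver using (solve-∀)
open import Data.Fin using (Fin)
import Data.Fin as Fin
open import Data.List using (List; []; _∷_; _++_; map; foldr; filter; filterᵇ; applyUpTo)
open import Data.List.Properties using (map-∘)
open import Data.List.Membership.Propositional using (_∈_)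
open import Data.List.Membership.Propositional.Properties
  using (∈-filter⁺; ∈-filter⁻; ∈-applyUpTo⁺; ∈-map⁺; ∈-map⁻; ∈-++⁺ˡ; ∈-++⁺ʳ; ∈-++⁻)
open import Data.List.Membership.Propositional.Properties.WithK using (unique∧set⇒bag)
open import Data.List.Relation.Unary.Any using (here; there)
import Data.List.Relation.Unary.All as All
open import Data.List.Relation.Unary.AllPairs using (_∷_)
open import Data.List.Relation.Unary.Unique.Propositional using (Unique)
import Data.List.Relation.Unary.Unique.Propositional.Properties as Unique
open import Data.List.Relation.Binary.BagAndSetEquality using (∼bag⇒↭)
open import Data.List.Relation.Binary.Permutation.Propositional using (_↭_; ↭⇒↭ₛ)
import Data.List.Relation.Binary.Permutation.Propositional.Properties as ↭
open import Data.List.Relation.Binary.Permutation.Setoid.Properties using (foldr-commMonoid)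
open import Data.Sum using (_⊎_; inj₁; inj₂; [_,_]′)
open import Data.Product using (_×_; _,_; proj₂; ∃-syntax)
open import Algebra.Bundles using (CommutativeMonoid)
open import Function using (_∘_)
open import Function.Bundles using (_⇔_; mk⇔; Equivalence)
open import Function.Construct.Composition using (_⇔-∘_)
open import Relation.Nullary using (yes; no; does; ¬_; contradiction)
open import Relation.Nullary.Decidable using (⌊_⌋; dec-true; dec-false)
open import Relation.Unary using (Decidable)
open import Relation.Binary.PropositionalEquality

open import Defs

open Equivalence using (to; from)

Σℤ : (ℕ → ℤ) → List ℕ → ℤ
Σℤ w xs = foldr _+ℤ_ 0ℤ (map w xs)

Σℤ-cong∈ : ∀ {w v} xs → (∀ {x} → x ∈ xs → w x ≡ v x) → Σℤ w xs ≡ Σℤ v xs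
Σℤ-cong∈ []       w≡v = refl
Σℤ-cong∈ (x ∷ xs) w≡v = cong₂ _+ℤ_ (w≡v (here refl)) (Σℤ-cong∈ xs (w≡v ∘ there))

Σℤ-cong : ∀ {w v} xs → (∀ x → w x ≡ v x) → Σℤ w xs ≡ Σℤ v xs
Σℤ-cong xs w≡v = Σℤ-cong∈ xs (λ {x} _ → w≡v x)

Σℤ-++ : ∀ w xs ys → Σℤ w (xs ++ ys) ≡ Σℤ w xs +ℤ Σℤ w ys
Σℤ-++ w []       ys = sym (ℤ.+-identityˡ _)
Σℤ-++ w (x ∷ xs) ys = trans (cong (w x +ℤ_) (Σℤ-++ w xs ys)) (sym (ℤ.+-assoc (w x) _ _))

Σℤ-map : ∀ w g xs → Σℤ w (map g xs) ≡ Σℤ (w ∘ g) xs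
Σℤ-map w g xs = cong (foldr _+ℤ_ 0ℤ) (sym (map-∘ xs))

Σℤ-↭ : ∀ w {xs ys} → xs ↭ ys → Σℤ w xs ≡ Σℤ w ys
Σℤ-↭ w xs↭ys = foldr-commMonoid +.setoid +.isCommutativeMonoid (↭⇒↭ₛ (↭.map⁺ w xs↭ys))
  where module + = CommutativeMonoid ℤ.+-0-commutativeMonoid

Σℤ-+ : ∀ w v xs → Σℤ (λ d → w d +ℤ v d) xs ≡ Σℤ w xs +ℤ Σℤ v xs
Σℤ-+ w v []       = refl
Σℤ-+ w v (x ∷ xs) = trans (cong (w x +ℤ v x +ℤ_) (Σℤ-+ w v xs)) (shuffle (w x) (v x) _ _)
  where
  shuffle : ∀ a b c e → (a +ℤ b) +ℤ (c +ℤ e) ≡ (a +ℤ c) +ℤ (b +ℤ e)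
  shuffle = solve-∀

Σℤ-* : ∀ c w xs → Σℤ (λ d → c *ℤ w d) xs ≡ c *ℤ Σℤ w xs
Σℤ-* c w []       = sym (ℤ.*-zeroʳ c)
Σℤ-* c w (x ∷ xs) = trans (cong (c *ℤ w x +ℤ_) (Σℤ-* c w xs)) (sym (ℤ.*-distribˡ-+ c (w x) _))

Σℤ-neg : ∀ w xs → Σℤ (λ d → - w d) xs ≡ - Σℤ w xs
Σℤ-neg w xs = trans (Σℤ-cong xs (λ d → sym (ℤ.-1*i≡-i (w d)))) (trans (Σℤ-* -1ℤ w xs) (ℤ.-1*i≡-i _))

Σℤ-− : ∀ w v xs → Σℤ (λ d → w d -ℤ v d) xs ≡ Σℤ w xs -ℤ Σℤ v xs
Σℤ-− w v xs = trans (Σℤ-+ w (λ d → - v d) xs) (cong (Σℤ w xs +ℤ_) (Σℤ-neg v xs))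

Σℤ-filter : ∀ {P : ℕ → Set} (P? : Decidable P) w xs →
  Σℤ w (filter P? xs) ≡ Σℤ (λ d → if does (P? d) then w d else 0ℤ) xs
Σℤ-filter P? w []       = refl
Σℤ-filter P? w (x ∷ xs) with does (P? x)
... | true  = cong (w x +ℤ_) (Σℤ-filter P? w xs)
... | false = trans (Σℤ-filter P? w xs) (sym (ℤ.+-identityˡ _))

Σℤ-pointChange : ∀ {w v a} xs → Unique xs → a ∈ xs → (∀ d → d ≢ a → w d ≡ v d) →
  Σℤ w xs -ℤ w a ≡ Σℤ v xs -ℤ v a
Σℤ-pointChange {w} {v} (x ∷ xs) (x∉xs ∷ _) (here refl) w≡v =
  begin
    (w x +ℤ Σℤ w xs) -ℤ w x  ≡⟨ cancel (w x) _ ⟩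
    Σℤ w xs                  ≡⟨ Σℤ-cong∈ xs (λ d∈xs → w≡v _ (≢-sym (All.lookup x∉xs d∈xs))) ⟩
    Σℤ v xs                  ≡⟨ cancel (v x) _ ⟨
    (v x +ℤ Σℤ v xs) -ℤ v x  ∎
  where
  open ≡-Reasoning
  cancel : ∀ a b → (a +ℤ b) -ℤ a ≡ b
  cancel = solve-∀
Σℤ-pointChange {w} {v} {a} (x ∷ xs) (x∉xs ∷ u) (there a∈xs) w≡v =
  begin
    (w x +ℤ Σℤ w xs) -ℤ w a  ≡⟨ ℤ.+-assoc (w x) _ _ ⟩
    w x +ℤ (Σℤ w xs -ℤ w a)  ≡⟨ cong₂ _+ℤ_ (w≡v x (All.lookup x∉xs a∈xs)) (Σℤ-pointChange xs u a∈xs w≡v) ⟩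
    v x +ℤ (Σℤ v xs -ℤ v a)  ≡⟨ ℤ.+-assoc (v x) _ _ ⟨
    (v x +ℤ Σℤ v xs) -ℤ v a  ∎
  where open ≡-Reasoning

sum-as-Σℤ : ∀ xs → + sum xs ≡ Σℤ +_ xs
sum-as-Σℤ []       = refl
sum-as-Σℤ (x ∷ xs) = trans (ℤ.pos-+ x (sum xs)) (cong (+ x +ℤ_) (sum-as-Σℤ xs))

mass : (ℕ → Bool) → ℕ → ℤ
mass g d = if g d then + d else 0ℤ

signed : Bool → ℕ → ℤ
signed b d = if b then + d else - + d

σ : (ℕ → Bool) → ℕ → ℤ
σ f d = signed (f d) d

sum-filterᵇ : ∀ g xs → + sum (filterᵇ g xs) ≡ Σℤ (mass g) xs
sum-filterᵇ g xs = trans (sum-as-Σℤ (filterᵇ g xs)) (Σℤ-filter _ +_ xs)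

sum-filterᵇ² : ∀ g s xs → + sum (filterᵇ s (filterᵇ g xs)) ≡ Σℤ (mass (λ d → g d ∧ s d)) xs
sum-filterᵇ² g s xs =
  trans (sum-filterᵇ s (filterᵇ g xs)) (trans (Σℤ-filter _ (mass s) xs) (Σℤ-cong xs restrict))
  where
  restrict : ∀ d → (if g d then mass s d else 0ℤ) ≡ mass (λ e → g e ∧ s e) d
  restrict d with g d
  ... | true  = refl
  ... | false = refl

signed-sum : ∀ f xs → + Σ⟨ f ⟩ xs -ℤ + Σ⟨¬ f ⟩ xs ≡ Σℤ (σ f) xs
signed-sum f xs =
  trans (cong₂ _-ℤ_ (sum-filterᵇ f xs) (sum-filterᵇ (not ∘ f) xs))
        (trans (sym (Σℤ-− (mass f) (mass (not ∘ f)) xs)) (Σℤ-cong xs difference))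
  where
  difference : ∀ d → mass f d -ℤ mass (not ∘ f) d ≡ σ f d
  difference d with f d
  ... | true  = ℤ.+-identityʳ (+ d)
  ... | false = ℤ.+-identityˡ (- + d)

signed-sum⁻ : ∀ f xs → + Σ⟨¬ f ⟩ xs -ℤ + Σ⟨ f ⟩ xs ≡ - Σℤ (σ f) xs
signed-sum⁻ f xs = trans (antisymmetric (+ Σ⟨ f ⟩ xs) (+ Σ⟨¬ f ⟩ xs)) (cong -_ (signed-sum f xs))
  where
  antisymmetric : ∀ a b → b -ℤ a ≡ - (a -ℤ b)
  antisymmetric = solve-∀

Σℤ-σ-not : ∀ f xs → Σℤ (σ (not ∘ f)) xs ≡ - Σℤ (σ f) xs
Σℤ-σ-not f xs = trans (Σℤ-cong xs flip) (Σℤ-neg (σ f) xs)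
  where
  flip : ∀ d → σ (not ∘ f) d ≡ - σ f d
  flip d with f d
  ... | true  = refl
  ... | false = sym (ℤ.neg-involutive (+ d))

divisors-unique : ∀ n → Unique (divisors n)
divisors-unique n =
  Unique.filter⁺ (_∣? n) (Unique.applyUpTo⁺₁ suc n (λ i<j _ → ℕ.<⇒≢ i<j ∘ ℕ.suc-injective))

∈-divisors⁺ : ∀ {n d} .{{_ : NonZero n}} → d ∣ n → d ∈ divisors n
∈-divisors⁺ {n} {0}     d∣n = contradiction (0∣⇒≡0 d∣n) (≢-nonZero⁻¹ n)
∈-divisors⁺ {n} {suc i} d∣n = ∈-filter⁺ (_∣? n) (∈-applyUpTo⁺ suc (∣⇒≤ d∣n)) d∣n

∈-divisors⁻ : ∀ {n d} → d ∈ divisors n → d ∣ n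
∈-divisors⁻ {n} d∈ = proj₂ (∈-filter⁻ (_∣? n) {xs = applyUpTo suc n} d∈)

prime∤divisor : ∀ {n p d} → Prime p → gcd n p ≡ 1 → d ∣ n → ¬ p ∣ d
prime∤divisor pr gcd≡1 d∣n p∣d =
  ¬prime[1] (subst Prime (gcd≡1⇒coprime gcd≡1 (∣-trans p∣d d∣n , ∣-refl)) pr)

divisors-*prime : ∀ {n p} .{{_ : NonZero n}} → Prime p → gcd n p ≡ 1 →
  divisors (n * p) ↭ divisors n ++ map (_* p) (divisors n)
divisors-*prime {n} {p} pr gcd≡1 =
  ∼bag⇒↭ (unique∧set⇒bag (divisors-unique (n * p)) unique-split (mk⇔ split join))
  where
  instance
    p≢0  = prime⇒nonZero pr
    np≢0 = ℕ.m*n≢0 n p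
  D = divisors n
  disjoint : ∀ {v} → ¬ (v ∈ D × v ∈ map (_* p) D)
  disjoint (v∈D , v∈Dp) with ∈-map⁻ (_* p) v∈Dp
  ... | d , _ , refl = prime∤divisor pr gcd≡1 (∈-divisors⁻ {n} v∈D) (n∣m*n d)
  unique-split : Unique (D ++ map (_* p) D)
  unique-split = Unique.++⁺ (divisors-unique n)
    (Unique.map⁺ (λ {d} {e} → ℕ.*-cancelʳ-≡ d e p) (divisors-unique n)) disjoint
  coprime-to-p : ∀ {x} → ¬ p ∣ x → Coprime x p
  coprime-to-p p∤x (c∣x , c∣p) with prime⇒irreducible pr c∣p
  ... | inj₁ c≡1 = c≡1
  ... | inj₂ refl = contradiction c∣x p∤x
  split : ∀ {x} → x ∈ divisors (n * p) → x ∈ D ++ map (_* p) D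
  split {x} x∈ with p ∣? x
  ... | yes (divides q refl) =
    ∈-++⁺ʳ D (∈-map⁺ (_* p) (∈-divisors⁺ {n} {q} (*-cancelʳ-∣ p (∈-divisors⁻ {n * p} x∈))))
  ... | no p∤x = ∈-++⁺ˡ (∈-divisors⁺
    (coprime-divisor (coprime-to-p p∤x) (subst (x ∣_) (ℕ.*-comm n p) (∈-divisors⁻ {n * p} x∈))))
  join : ∀ {x} → x ∈ D ++ map (_* p) D → x ∈ divisors (n * p)
  join x∈ with ∈-++⁻ D x∈
  ... | inj₁ x∈D = ∈-divisors⁺ (∣m⇒∣m*n p (∈-divisors⁻ {n} x∈D))
  ... | inj₂ x∈Dp with ∈-map⁻ (_* p) x∈Dp
  ... | d , d∈D , refl = ∈-divisors⁺ (*-monoˡ-∣ p (∈-divisors⁻ {n} d∈D))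

Σℤ-properDivisors : ∀ w m .{{_ : NonZero m}} →
  Σℤ w (properDivisors m) ≡ Σℤ w (divisors m) -ℤ w m
Σℤ-properDivisors w m =
  begin
    Σℤ w (properDivisors m)  ≡⟨ Σℤ-filter _ w (divisors m) ⟩
    Σℤ w′ (divisors m)       ≡⟨ ℤ.+-identityʳ _ ⟨
    Σℤ w′ (divisors m) -ℤ 0ℤ ≡⟨ cong (λ c → Σℤ w′ (divisors m) -ℤ c) w′-top ⟨
    Σℤ w′ (divisors m) -ℤ w′ m
      ≡⟨ Σℤ-pointChange (divisors m) (divisors-unique m) (∈-divisors⁺ ∣-refl) w′-off-top ⟩
    Σℤ w (divisors m) -ℤ w m ∎
  where
  open ≡-Reasoning
  w′ : ℕ → ℤ
  w′ d = if not (does (d ≟ m)) then w d else 0ℤ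
  w′-top : w′ m ≡ 0ℤ
  w′-top = cong (λ b → if not b then w m else 0ℤ) (dec-true (m ≟ m) refl)
  w′-off-top : ∀ d → d ≢ m → w′ d ≡ w d
  w′-off-top d d≢m = cong (λ b → if not b then w d else 0ℤ) (dec-false (d ≟ m) d≢m)

Σℤ-properDivisors-*prime : ∀ w {n p} .{{_ : NonZero n}} → Prime p → gcd n p ≡ 1 →
  Σℤ w (properDivisors (n * p)) ≡ Σℤ w (divisors n) +ℤ (Σℤ (w ∘ (_* p)) (divisors n) -ℤ w (n * p))
Σℤ-properDivisors-*prime w {n} {p} pr gcd≡1 =
  begin
    Σℤ w (properDivisors (n * p))
      ≡⟨ Σℤ-properDivisors w (n * p) ⟩
    Σℤ w (divisors (n * p)) -ℤ w (n * p)
      ≡⟨ cong (_-ℤ w (n * p)) (Σℤ-↭ w (divisors-*prime pr gcd≡1)) ⟩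
    Σℤ w (D ++ map (_* p) D) -ℤ w (n * p)
      ≡⟨ cong (_-ℤ w (n * p)) (trans (Σℤ-++ w D _) (cong (Σℤ w D +ℤ_) (Σℤ-map w (_* p) D))) ⟩
    (Σℤ w D +ℤ Σℤ (w ∘ (_* p)) D) -ℤ w (n * p)
      ≡⟨ ℤ.+-assoc (Σℤ w D) _ _ ⟩
    Σℤ w D +ℤ (Σℤ (w ∘ (_* p)) D -ℤ w (n * p)) ∎
  where
  open ≡-Reasoning
  instance
    p≢0  = prime⇒nonZero pr
    np≢0 = ℕ.m*n≢0 n p
  D = divisors n

halfZumkeller⇔ : ∀ m → HalfZumkeller m ⇔ (∃[ F ] Σℤ (σ F) (properDivisors m) ≡ 0ℤ)
halfZumkeller⇔ m = mk⇔
  (λ (F , equal) → F , trans (sym (signed-sum F P)) (ℤ.i≡j⇒i-j≡0 (cong +_ equal)))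
  (λ (F , zero) → F , ℤ.+-injective (ℤ.i-j≡0⇒i≡j _ _ (trans (signed-sum F P) zero)))
  where P = properDivisors m

balanced-wlog : ∀ xs a F → Σℤ (σ F) xs ≡ 0ℤ → ∃[ G ] (G a ≡ true × Σℤ (σ G) xs ≡ 0ℤ)
balanced-wlog xs a F balanced with F a in Fa
... | true  = F , Fa , balanced
... | false = not ∘ F , cong not Fa , trans (Σℤ-σ-not F xs) (cong -_ balanced)

signed-cong : ∀ {b c d} → b ≡ c → signed b d ≡ signed c d
signed-cong {d = d} = cong (λ b → signed b d)

σ-scale : ∀ p F d → σ F (d * p) ≡ + p *ℤ σ (F ∘ (_* p)) d
σ-scale p F d with F (d * p)
... | true  = +dp≡+p*+d
  where +dp≡+p*+d = trans (ℤ.pos-* d p) (ℤ.*-comm (+ d) (+ p))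
... | false = trans (cong -_ +dp≡+p*+d) (ℤ.neg-distribʳ-* (+ p) (+ d))
  where +dp≡+p*+d = trans (ℤ.pos-* d p) (ℤ.*-comm (+ d) (+ p))

_[_↦_] : (ℕ → Bool) → ℕ → Bool → ℕ → Bool
(f [ a ↦ b ]) d = if does (d ≟ a) then b else f d

update-≡ : ∀ f a b → (f [ a ↦ b ]) a ≡ b
update-≡ f a b = cong (λ c → if c then b else f a) (dec-true (a ≟ a) refl)

update-≢ : ∀ f {a d} b → d ≢ a → (f [ a ↦ b ]) d ≡ f d
update-≢ f {a} {d} b d≢a = cong (λ c → if c then b else f d) (dec-false (d ≟ a) d≢a)

exchange-arithmetic : ∀ F K G x y → F -ℤ (x +ℤ x) ≡ K -ℤ y → K -ℤ - x ≡ G -ℤ x → F ≡ G -ℤ y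
exchange-arithmetic F K G x y F≡K K≡G =
  begin
    F                           ≡⟨ unfoldF F x ⟩
    (F -ℤ (x +ℤ x)) +ℤ (x +ℤ x) ≡⟨ cong (_+ℤ (x +ℤ x)) F≡K ⟩
    (K -ℤ y) +ℤ (x +ℤ x)        ≡⟨ unfoldK K x y ⟩
    (K -ℤ - x) +ℤ (x -ℤ y)      ≡⟨ cong (_+ℤ (x -ℤ y)) K≡G ⟩
    (G -ℤ x) +ℤ (x -ℤ y)        ≡⟨ cancel G x y ⟩
    G -ℤ y                      ∎
  where
  open ≡-Reasoning
  unfoldF : ∀ F x → F ≡ (F -ℤ (x +ℤ x)) +ℤ (x +ℤ x)
  unfoldF = solve-∀
  unfoldK : ∀ K x y → (K -ℤ y) +ℤ (x +ℤ x) ≡ (K -ℤ - x) +ℤ (x -ℤ y)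
  unfoldK = solve-∀
  cancel : ∀ G x y → (G -ℤ x) +ℤ (x -ℤ y) ≡ G -ℤ y
  cancel = solve-∀

-- If g
-- puts h on the plus side, and f agrees with g except that n is put on the plus
-- side and h on the minus side, then  Σ σ f = Σ σ g − σ g n :  moving h to the
-- minus side costs 2h = n, which is what putting n on the plus side gains.
Σℤ-σ-exchange : ∀ xs {n h} (f g : ℕ → Bool) → Unique xs → n ∈ xs → h ∈ xs →
  h + h ≡ n → h ≢ n → g h ≡ true → f n ≡ true → f h ≡ false →
  (∀ d → d ≢ n → d ≢ h → f d ≡ g d) →
  Σℤ (σ f) xs ≡ Σℤ (σ g) xs -ℤ σ g n
Σℤ-σ-exchange xs {n} {h} f g uniq n∈ h∈ h+h≡n h≢n gh fn fh f≡g =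
  exchange-arithmetic (Σℤ (σ f) xs) (Σℤ (σ k) xs) (Σℤ (σ g) xs) (+ h) (σ g n) f-to-k k-to-g
  where
  open ≡-Reasoning
  k : ℕ → Bool
  k = g [ h ↦ false ]
  f-to-k : Σℤ (σ f) xs -ℤ (+ h +ℤ + h) ≡ Σℤ (σ k) xs -ℤ σ g n
  f-to-k =
    begin
      Σℤ (σ f) xs -ℤ (+ h +ℤ + h)
        ≡⟨ cong (λ c → Σℤ (σ f) xs -ℤ c) (trans (signed-cong fn) (trans (cong +_ (sym h+h≡n)) (ℤ.pos-+ h h))) ⟨
      Σℤ (σ f) xs -ℤ σ f n
        ≡⟨ Σℤ-pointChange xs uniq n∈ f≡k-off-n ⟩
      Σℤ (σ k) xs -ℤ σ k n
        ≡⟨ cong (λ c → Σℤ (σ k) xs -ℤ c) (signed-cong (update-≢ g false (≢-sym h≢n))) ⟩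
      Σℤ (σ k) xs -ℤ σ g n ∎
    where
    f≡k-off-n : ∀ d → d ≢ n → σ f d ≡ σ k d
    f≡k-off-n d d≢n with d ≟ h
    ... | yes refl = signed-cong (trans fh (sym (update-≡ g h false)))
    ... | no d≢h   = signed-cong (trans (f≡g d d≢n d≢h) (sym (update-≢ g false d≢h)))
  k-to-g : Σℤ (σ k) xs -ℤ - + h ≡ Σℤ (σ g) xs -ℤ + h
  k-to-g =
    begin
      Σℤ (σ k) xs -ℤ - + h
        ≡⟨ cong (λ c → Σℤ (σ k) xs -ℤ c) (signed-cong (update-≡ g h false)) ⟨
      Σℤ (σ k) xs -ℤ σ k h
        ≡⟨ Σℤ-pointChange xs uniq h∈ (λ d d≢h → signed-cong (update-≢ g false d≢h)) ⟩
      Σℤ (σ g) xs -ℤ σ g h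
        ≡⟨ cong (λ c → Σℤ (σ g) xs -ℤ c) (signed-cong gh) ⟩
      Σℤ (σ g) xs -ℤ + h ∎

-- A labelling c : ℕ → Fin 4 splits the divisors into
-- the classes A₁,…,A₄ of condition (iv); each class carries a coefficient
-- κ P, and c is balanced when Σ κ P (c d) · d vanishes.  With P = p this
-- is the equation of (iv), and it is also what (ii) and (iii) express.

A₁ A₂ A₃ A₄ : Fin 4
A₁ = Fin.zero
A₂ = Fin.suc Fin.zero
A₃ = Fin.suc (Fin.suc Fin.zero)
A₄ = Fin.suc (Fin.suc (Fin.suc Fin.zero))

κ : ℤ → Fin 4 → ℤ
κ P Fin.zero                               = - (P +ℤ 1ℤ)
κ P (Fin.suc Fin.zero)                     = 1ℤ -ℤ P
κ P (Fin.suc (Fin.suc Fin.zero))           = P +ℤ 1ℤ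
κ P (Fin.suc (Fin.suc (Fin.suc Fin.zero))) = P -ℤ 1ℤ

κ-weight : ℤ → (ℕ → Fin 4) → ℕ → ℤ
κ-weight P c d = κ P (c d) *ℤ + d

label : (f s t : ℕ → Bool) → ℕ → Fin 4
label f s t d = if f d then (if t d then A₄ else A₃) else (if s d then A₂ else A₁)

Σκ-label : ∀ P f s t xs →
  Σℤ (κ-weight P (label f s t)) xs
    ≡ + 2 *ℤ (Σℤ (mass (λ d → not (f d) ∧ s d)) xs -ℤ Σℤ (mass (λ d → f d ∧ t d)) xs)
      +ℤ (P +ℤ 1ℤ) *ℤ Σℤ (σ f) xs
Σκ-label P f s t xs =
  trans (Σℤ-cong xs pointwise)
    (trans (Σℤ-+ _ _ xs)
      (cong₂ _+ℤ_ (trans (Σℤ-* (+ 2) _ xs) (cong (+ 2 *ℤ_) (Σℤ-− _ _ xs))) (Σℤ-* (P +ℤ 1ℤ) (σ f) xs)))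
  where
  pointwise : ∀ d → κ-weight P (label f s t) d
    ≡ + 2 *ℤ (mass (λ e → not (f e) ∧ s e) d -ℤ mass (λ e → f e ∧ t e) d) +ℤ (P +ℤ 1ℤ) *ℤ σ f d
  pointwise d with f d | s d | t d
  ... | true  | _     | true  = inA₄ P (+ d)
    where
    inA₄ : ∀ P x → (P -ℤ 1ℤ) *ℤ x ≡ + 2 *ℤ (0ℤ -ℤ x) +ℤ (P +ℤ 1ℤ) *ℤ x
    inA₄ = solve-∀
  ... | true  | _     | false = inA₃ P (+ d)
    where
    inA₃ : ∀ P x → (P +ℤ 1ℤ) *ℤ x ≡ + 2 *ℤ (0ℤ -ℤ 0ℤ) +ℤ (P +ℤ 1ℤ) *ℤ x
    inA₃ = solve-∀
  ... | false | true  | _     = inA₂ P (+ d)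
    where
    inA₂ : ∀ P x → (1ℤ -ℤ P) *ℤ x ≡ + 2 *ℤ (x -ℤ 0ℤ) +ℤ (P +ℤ 1ℤ) *ℤ - x
    inA₂ = solve-∀
  ... | false | false | _     = inA₁ P (+ d)
    where
    inA₁ : ∀ P x → - (P +ℤ 1ℤ) *ℤ x ≡ + 2 *ℤ (0ℤ -ℤ 0ℤ) +ℤ (P +ℤ 1ℤ) *ℤ - x
    inA₁ = solve-∀

Σκ-signs : ∀ P f s xs →
  Σℤ (κ-weight P (label f s (not ∘ s))) xs ≡ P *ℤ Σℤ (σ f) xs +ℤ Σℤ (σ s) xs
Σκ-signs P f s xs =
  trans (Σℤ-cong xs pointwise) (trans (Σℤ-+ _ _ xs) (cong (_+ℤ Σℤ (σ s) xs) (Σℤ-* P (σ f) xs)))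
  where
  pointwise : ∀ d → κ-weight P (label f s (not ∘ s)) d ≡ P *ℤ σ f d +ℤ σ s d
  pointwise d with f d | s d
  ... | true  | true  = inA₃ P (+ d)
    where
    inA₃ : ∀ P x → (P +ℤ 1ℤ) *ℤ x ≡ P *ℤ x +ℤ x
    inA₃ = solve-∀
  ... | true  | false = inA₄ P (+ d)
    where
    inA₄ : ∀ P x → (P -ℤ 1ℤ) *ℤ x ≡ P *ℤ x +ℤ - x
    inA₄ = solve-∀
  ... | false | true  = inA₂ P (+ d)
    where
    inA₂ : ∀ P x → (1ℤ -ℤ P) *ℤ x ≡ P *ℤ - x +ℤ x
    inA₂ = solve-∀
  ... | false | false = inA₁ P (+ d)
    where
    inA₁ : ∀ P x → - (P +ℤ 1ℤ) *ℤ x ≡ P *ℤ - x +ℤ - x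
    inA₁ = solve-∀

inClass : (ℕ → Fin 4) → Fin 4 → ℕ → ℤ
inClass c i = mass (λ d → ⌊ c d Fin.≟ i ⌋)

Σκ-classes : ∀ P c xs →
  Σℤ (κ-weight P c) xs
    ≡ (P +ℤ 1ℤ) *ℤ (Σℤ (inClass c A₃) xs -ℤ Σℤ (inClass c A₁) xs)
      +ℤ (P -ℤ 1ℤ) *ℤ (Σℤ (inClass c A₄) xs -ℤ Σℤ (inClass c A₂) xs)
Σκ-classes P c xs =
  trans (Σℤ-cong xs pointwise)
    (trans (Σℤ-+ _ _ xs)
      (cong₂ _+ℤ_ (trans (Σℤ-* (P +ℤ 1ℤ) _ xs) (cong ((P +ℤ 1ℤ) *ℤ_) (Σℤ-− _ _ xs)))
                  (trans (Σℤ-* (P -ℤ 1ℤ) _ xs) (cong ((P -ℤ 1ℤ) *ℤ_) (Σℤ-− _ _ xs)))))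
  where
  pointwise : ∀ d → κ-weight P c d
    ≡ (P +ℤ 1ℤ) *ℤ (inClass c A₃ d -ℤ inClass c A₁ d) +ℤ (P -ℤ 1ℤ) *ℤ (inClass c A₄ d -ℤ inClass c A₂ d)
  pointwise d with c d
  ... | Fin.zero                               = inA₁ P (+ d)
    where
    inA₁ : ∀ P x → - (P +ℤ 1ℤ) *ℤ x ≡ (P +ℤ 1ℤ) *ℤ (0ℤ -ℤ x) +ℤ (P -ℤ 1ℤ) *ℤ (0ℤ -ℤ 0ℤ)
    inA₁ = solve-∀
  ... | Fin.suc Fin.zero                       = inA₂ P (+ d)
    where
    inA₂ : ∀ P x → (1ℤ -ℤ P) *ℤ x ≡ (P +ℤ 1ℤ) *ℤ (0ℤ -ℤ 0ℤ) +ℤ (P -ℤ 1ℤ) *ℤ (0ℤ -ℤ x)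
    inA₂ = solve-∀
  ... | Fin.suc (Fin.suc Fin.zero)             = inA₃ P (+ d)
    where
    inA₃ : ∀ P x → (P +ℤ 1ℤ) *ℤ x ≡ (P +ℤ 1ℤ) *ℤ (x -ℤ 0ℤ) +ℤ (P -ℤ 1ℤ) *ℤ (0ℤ -ℤ 0ℤ)
    inA₃ = solve-∀
  ... | Fin.suc (Fin.suc (Fin.suc Fin.zero))   = inA₄ P (+ d)
    where
    inA₄ : ∀ P x → (P -ℤ 1ℤ) *ℤ x ≡ (P +ℤ 1ℤ) *ℤ (0ℤ -ℤ 0ℤ) +ℤ (P -ℤ 1ℤ) *ℤ (x -ℤ 0ℤ)
    inA₄ = solve-∀

-- Each of the equations in (ii)–(iv) says that a difference of two sides
-- vanishes; these lemmas identify that difference with a κ-sum (or, for (ii),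
-- with the signed sum P Σ σ f + Σ σ s).

Balanced : ℤ → (ℕ → Fin 4) → List ℕ → Set
Balanced P c xs = Σℤ (κ-weight P c) xs ≡ 0ℤ

vanish⇔ : ∀ {x y z : ℤ} → z ≡ y -ℤ x → (x ≡ y) ⇔ (z ≡ 0ℤ)
vanish⇔ {x} {y} z≡y-x = mk⇔
  (λ x≡y → trans z≡y-x (ℤ.i≡j⇒i-j≡0 (sym x≡y)))
  (λ z≡0 → sym (ℤ.i-j≡0⇒i≡j y x (trans (sym z≡y-x) z≡0)))

cond2-eq⇔ : ∀ P f s xs →
  (P *ℤ (+ Σ⟨¬ f ⟩ xs -ℤ + Σ⟨ f ⟩ xs) ≡ + Σ⟨ s ⟩ xs -ℤ + Σ⟨¬ s ⟩ xs)
    ⇔ (P *ℤ Σℤ (σ f) xs +ℤ Σℤ (σ s) xs ≡ 0ℤ)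
cond2-eq⇔ P f s xs = vanish⇔
  (trans (reorder P (Σℤ (σ f) xs) (Σℤ (σ s) xs))
         (sym (cong₂ (λ a b → a -ℤ P *ℤ b) (signed-sum s xs) (signed-sum⁻ f xs))))
  where
  reorder : ∀ P a b → P *ℤ a +ℤ b ≡ b -ℤ P *ℤ - a
  reorder = solve-∀

cond3-eq⇔ : ∀ p f s t xs →
  (+ 2 *ℤ (+ sum (filterᵇ s (filterᵇ (λ d → not (f d)) xs)) -ℤ + sum (filterᵇ t (filterᵇ f xs)))
     ≡ + (p + 1) *ℤ (+ Σ⟨¬ f ⟩ xs -ℤ + Σ⟨ f ⟩ xs))
    ⇔ Balanced (+ p) (label f s t) xs
cond3-eq⇔ p f s t xs = vanish⇔ difference ⇔-∘ mk⇔ sym sym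
  where
  open ≡-Reasoning
  S T : ℤ
  S = Σℤ (mass (λ d → not (f d) ∧ s d)) xs
  T = Σℤ (mass (λ d → f d ∧ t d)) xs
  reorder : ∀ P S T X → + 2 *ℤ (S -ℤ T) +ℤ (P +ℤ 1ℤ) *ℤ X ≡ + 2 *ℤ (S -ℤ T) -ℤ (P +ℤ 1ℤ) *ℤ - X
  reorder = solve-∀
  difference : Σℤ (κ-weight (+ p) (label f s t)) xs
    ≡ + 2 *ℤ (+ sum (filterᵇ s (filterᵇ (λ d → not (f d)) xs)) -ℤ + sum (filterᵇ t (filterᵇ f xs)))
      -ℤ + (p + 1) *ℤ (+ Σ⟨¬ f ⟩ xs -ℤ + Σ⟨ f ⟩ xs)
  difference =
    begin
      Σℤ (κ-weight (+ p) (label f s t)) xs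
        ≡⟨ Σκ-label (+ p) f s t xs ⟩
      + 2 *ℤ (S -ℤ T) +ℤ (+ p +ℤ 1ℤ) *ℤ Σℤ (σ f) xs
        ≡⟨ reorder (+ p) S T (Σℤ (σ f) xs) ⟩
      + 2 *ℤ (S -ℤ T) -ℤ (+ p +ℤ 1ℤ) *ℤ - Σℤ (σ f) xs
        ≡⟨ cong₂ (λ a b → + 2 *ℤ a -ℤ b)
             (cong₂ _-ℤ_ (sum-filterᵇ² _ s xs) (sum-filterᵇ² f t xs))
             (cong₂ _*ℤ_ (ℤ.pos-+ p 1) (signed-sum⁻ f xs)) ⟨
      + 2 *ℤ (+ sum (filterᵇ s (filterᵇ (λ d → not (f d)) xs)) -ℤ + sum (filterᵇ t (filterᵇ f xs)))
        -ℤ + (p + 1) *ℤ (+ Σ⟨¬ f ⟩ xs -ℤ + Σ⟨ f ⟩ xs) ∎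

cond4-eq⇔ : ∀ p .{{_ : NonZero p}} c xs →
  ((p + 1) * part c A₁ xs + (p ∸ 1) * part c A₂ xs ≡ (p + 1) * part c A₃ xs + (p ∸ 1) * part c A₄ xs)
    ⇔ Balanced (+ p) c xs
cond4-eq⇔ (suc q) c xs = vanish⇔ difference ⇔-∘ mk⇔ (cong (λ m → + m)) ℤ.+-injective
  where
  open ≡-Reasoning
  P = + suc q
  C : Fin 4 → ℤ
  C i = Σℤ (inClass c i) xs
  -- + (p ∸ 1) is P - 1 by computation, as p = suc q.
  toℤ : ∀ a b → + ((suc q + 1) * a + q * b) ≡ (P +ℤ 1ℤ) *ℤ + a +ℤ (P -ℤ 1ℤ) *ℤ + b
  toℤ a b = trans (ℤ.pos-+ _ (q * b))
    (cong₂ _+ℤ_ (trans (ℤ.pos-* (suc q + 1) a) (cong (_*ℤ + a) (ℤ.pos-+ (suc q) 1)))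
                (ℤ.pos-* q b))
  reorder : ∀ P a b c d → (P +ℤ 1ℤ) *ℤ (c -ℤ a) +ℤ (P -ℤ 1ℤ) *ℤ (d -ℤ b)
    ≡ ((P +ℤ 1ℤ) *ℤ c +ℤ (P -ℤ 1ℤ) *ℤ d) -ℤ ((P +ℤ 1ℤ) *ℤ a +ℤ (P -ℤ 1ℤ) *ℤ b)
  reorder = solve-∀
  toClasses : ∀ i j → + ((suc q + 1) * part c i xs + q * part c j xs)
    ≡ (P +ℤ 1ℤ) *ℤ C i +ℤ (P -ℤ 1ℤ) *ℤ C j
  toClasses i j = trans (toℤ _ _)
    (cong₂ (λ a b → (P +ℤ 1ℤ) *ℤ a +ℤ (P -ℤ 1ℤ) *ℤ b) (sum-filterᵇ _ xs) (sum-filterᵇ _ xs))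
  difference : Σℤ (κ-weight P c) xs
    ≡ + ((suc q + 1) * part c A₃ xs + q * part c A₄ xs) -ℤ + ((suc q + 1) * part c A₁ xs + q * part c A₂ xs)
  difference =
    begin
      Σℤ (κ-weight P c) xs
        ≡⟨ Σκ-classes P c xs ⟩
      (P +ℤ 1ℤ) *ℤ (C A₃ -ℤ C A₁) +ℤ (P -ℤ 1ℤ) *ℤ (C A₄ -ℤ C A₂)
        ≡⟨ reorder P (C A₁) (C A₂) (C A₃) (C A₄) ⟩
      ((P +ℤ 1ℤ) *ℤ C A₃ +ℤ (P -ℤ 1ℤ) *ℤ C A₄) -ℤ ((P +ℤ 1ℤ) *ℤ C A₁ +ℤ (P -ℤ 1ℤ) *ℤ C A₂)
        ≡⟨ cong₂ _-ℤ_ (toClasses A₃ A₄) (toClasses A₁ A₂) ⟨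
      + ((suc q + 1) * part c A₃ xs + q * part c A₄ xs) -ℤ + ((suc q + 1) * part c A₁ xs + q * part c A₂ xs) ∎

Balanced-cong : ∀ {P c c′} xs → (∀ d → c d ≡ c′ d) → Balanced P c xs → Balanced P c′ xs
Balanced-cong {P} xs c≡c′ = trans (Σℤ-cong xs (λ d → cong (λ i → κ P i *ℤ + d) (sym (c≡c′ d))))

label-D₁ : ∀ f s t {d} → f d ≡ true → label f s t d ≡ A₄ ⊎ label f s t d ≡ A₃
label-D₁ f s t {d} fd rewrite fd with t d
... | true  = inj₁ refl
... | false = inj₂ refl

label-D₂ : ∀ f s t {d} → f d ≡ false → label f s t d ≡ A₁ ⊎ label f s t d ≡ A₂
label-D₂ f s t {d} fd rewrite fd with s d
... | true  = inj₂ refl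
... | false = inj₁ refl

-- (ii) ⇔ (iii), for all n and p.  A signing s of D yields S = D₂ ∩ s and
-- T = D₁ ∖ s; conversely S and T yield the signing that is s on D₂ and
-- the complement of T on D₁.  In both directions the labellings agree.
cond2⇔cond3 : ∀ n p → Cond2 n p ⇔ Cond3 n p
cond2⇔cond3 n p = mk⇔ ii⇒iii iii⇒ii
  where
  D = divisors n
  ii⇒iii : Cond2 n p → Cond3 n p
  ii⇒iii (f , fn , fh , s , eq) = f , fn , fh , s , not ∘ s ,
    from (cond3-eq⇔ p f s (not ∘ s) D) (trans (Σκ-signs (+ p) f s D) (to (cond2-eq⇔ (+ p) f s D) eq))
  iii⇒ii : Cond3 n p → Cond2 n p
  iii⇒ii (f , fn , fh , s , t , eq) = f , fn , fh , s′ ,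
    from (cond2-eq⇔ (+ p) f s′ D)
      (trans (sym (Σκ-signs (+ p) f s′ D)) (Balanced-cong D same-label (to (cond3-eq⇔ p f s t D) eq)))
    where
    s′ : ℕ → Bool
    s′ d = if f d then not (t d) else s d
    same-label : ∀ d → label f s t d ≡ label f s′ (not ∘ s′) d
    same-label d with f d | t d
    ... | true  | true  = refl
    ... | true  | false = refl
    ... | false | _     = refl

upper isA₂ isA₄ : Fin 4 → Bool
upper Fin.zero                   = false
upper (Fin.suc Fin.zero)         = false
upper (Fin.suc (Fin.suc _))      = true
isA₂ (Fin.suc Fin.zero)          = true
isA₂ _                           = false
isA₄ (Fin.suc (Fin.suc (Fin.suc Fin.zero))) = true
isA₄ _                                     = false

label-decode : ∀ c d → label (upper ∘ c) (isA₂ ∘ c) (isA₄ ∘ c) d ≡ c d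
label-decode c d with c d
... | Fin.zero                               = refl
... | Fin.suc Fin.zero                       = refl
... | Fin.suc (Fin.suc Fin.zero)             = refl
... | Fin.suc (Fin.suc (Fin.suc Fin.zero))   = refl

cond3⇔cond4 : ∀ n p .{{_ : NonZero p}} → Cond3 n p ⇔ Cond4 n p
cond3⇔cond4 n p = mk⇔ iii⇒iv iv⇒iii
  where
  D = divisors n
  iii⇒iv : Cond3 n p → Cond4 n p
  iii⇒iv (f , fn , fh , s , t , eq) = label f s t , label-D₁ f s t fn , label-D₂ f s t fh ,
    from (cond4-eq⇔ p (label f s t) D) (to (cond3-eq⇔ p f s t D) eq)
  iv⇒iii : Cond4 n p → Cond3 n p
  iv⇒iii (c , cn , ch , eq) = upper ∘ c , [ cong upper , cong upper ]′ cn , [ cong upper , cong upper ]′ ch ,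
    isA₂ ∘ c , isA₄ ∘ c ,
    from (cond3-eq⇔ p _ _ _ D) (Balanced-cong D (λ d → sym (label-decode c d)) (to (cond4-eq⇔ p c D) eq))

half+half : ∀ n → 2 ∣ n → n / 2 + n / 2 ≡ n
half+half .(q * 2) (divides q refl) =
  trans (cong (λ h → h + h) (m*n/n≡m q 2))
        (sym (trans (ℕ.*-comm q 2) (cong (λ m → q + m) (ℕ.+-identityʳ q))))

half≢n : ∀ n .{{_ : NonZero n}} → n / 2 ≢ n
half≢n n = ℕ.<⇒≢ (m/n<m n 2 (ℕ.n<1+n 1))

-- A number coprime to a prime is nonzero, since gcd 0 p = p.
coprime⇒nonZero : ∀ n {p} → Prime p → gcd n p ≡ 1 → NonZero n
coprime⇒nonZero 0       {p} p-prime gcd≡1 =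
  contradiction (subst Prime (gcd≡1⇒coprime {0} {p} gcd≡1 (p ∣0 , ∣-refl)) p-prime) ¬prime[1]
coprime⇒nonZero (suc _)     _     _     = _

-- A signing F of the proper divisors of n·p splits, by
-- divisors-*prime, into a signing s of D and (through d ↦ d·p) a signing of
-- D ∖ {n}; the exchange step turns the latter into a signing f of all of D
-- with n on the plus side and n/2 on the minus side.
module FirstEquivalence {n p : ℕ} .{{_ : NonZero n}} (p-prime : Prime p) (gcd≡1 : gcd n p ≡ 1)
  (2∣n : 2 ∣ n) where

  half : ℕ
  half = n / 2

  D : List ℕ
  D = divisors n

  Σσ-properDivisors : ∀ F f → F (half * p) ≡ true → f n ≡ true → f half ≡ false →
    (∀ d → d ≢ n → d ≢ half → f d ≡ F (d * p)) →
    Σℤ (σ F) (properDivisors (n * p)) ≡ + p *ℤ Σℤ (σ f) D +ℤ Σℤ (σ F) D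
  Σσ-properDivisors F f Fhp fn fh f≡F =
    begin
      Σℤ (σ F) (properDivisors (n * p))
        ≡⟨ Σℤ-properDivisors-*prime (σ F) p-prime gcd≡1 ⟩
      Σℤ (σ F) D +ℤ (Σℤ (σ F ∘ (_* p)) D -ℤ σ F (n * p))
        ≡⟨ cong (Σℤ (σ F) D +ℤ_) scaled ⟩
      Σℤ (σ F) D +ℤ + p *ℤ (Σℤ (σ h) D -ℤ σ h n)
        ≡⟨ cong (λ x → Σℤ (σ F) D +ℤ + p *ℤ x) exchanged ⟨
      Σℤ (σ F) D +ℤ + p *ℤ Σℤ (σ f) D
        ≡⟨ ℤ.+-comm (Σℤ (σ F) D) _ ⟩
      + p *ℤ Σℤ (σ f) D +ℤ Σℤ (σ F) D ∎
    where
    open ≡-Reasoning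
    h : ℕ → Bool
    h = F ∘ (_* p)
    distrib : ∀ P a b → P *ℤ a -ℤ P *ℤ b ≡ P *ℤ (a -ℤ b)
    distrib = solve-∀
    scaled : Σℤ (σ F ∘ (_* p)) D -ℤ σ F (n * p) ≡ + p *ℤ (Σℤ (σ h) D -ℤ σ h n)
    scaled = trans (cong₂ _-ℤ_ (trans (Σℤ-cong D (σ-scale p F)) (Σℤ-* (+ p) (σ h) D)) (σ-scale p F n))
                   (distrib (+ p) _ _)
    exchanged : Σℤ (σ f) D ≡ Σℤ (σ h) D -ℤ σ h n
    exchanged = Σℤ-σ-exchange D f h (divisors-unique n) (∈-divisors⁺ ∣-refl)
      (∈-divisors⁺ (m/n∣m 2∣n)) (half+half n 2∣n) (half≢n n) Fhp fn fh f≡F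

  i⇒ii : HalfZumkeller (n * p) → Cond2 n p
  i⇒ii hz with to (halfZumkeller⇔ (n * p)) hz
  ... | F₀ , balanced₀ with balanced-wlog (properDivisors (n * p)) (half * p) F₀ balanced₀
  ... | F , Fhp , balanced = f , update-≡ k n true , f-half , F ,
    from (cond2-eq⇔ (+ p) f F D) (trans (sym (Σσ-properDivisors F f Fhp (update-≡ k n true) f-half f≡F)) balanced)
    where
    h k f : ℕ → Bool
    h = F ∘ (_* p)
    k = h [ half ↦ false ]
    f = k [ n ↦ true ]
    f-half : f half ≡ false
    f-half = trans (update-≢ k true (half≢n n)) (update-≡ h half false)
    f≡F : ∀ d → d ≢ n → d ≢ half → f d ≡ F (d * p)
    f≡F d d≢n d≢half = trans (update-≢ k true d≢n) (update-≢ h false d≢half)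

  ii⇒i : Cond2 n p → HalfZumkeller (n * p)
  ii⇒i (f , fn , fh , s , eq) = from (halfZumkeller⇔ (n * p)) (F , balanced)
    where
    open ≡-Reasoning
    instance
      p≢0 : NonZero p
      p≢0 = prime⇒nonZero p-prime
    g : ℕ → Bool
    g = f [ half ↦ true ]
    F : ℕ → Bool
    F d = if does (p ∣? d) then g (d / p) else s d
    F-on-D : ∀ {d} → d ∈ D → F d ≡ s d
    F-on-D {d} d∈D = cong (λ b → if b then g (d / p) else s d)
      (dec-false (p ∣? d) (prime∤divisor p-prime gcd≡1 (∈-divisors⁻ {n} d∈D)))
    F-scaled : ∀ d → F (d * p) ≡ g d
    F-scaled d = trans (cong (λ b → if b then g (d * p / p) else s (d * p)) (dec-true (p ∣? d * p) (n∣m*n d)))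
                       (cong g (m*n/n≡m d p))
    balanced : Σℤ (σ F) (properDivisors (n * p)) ≡ 0ℤ
    balanced =
      begin
        Σℤ (σ F) (properDivisors (n * p))
          ≡⟨ Σσ-properDivisors F f (trans (F-scaled half) (update-≡ f half true)) fn fh
               (λ d _ d≢half → sym (trans (F-scaled d) (update-≢ f true d≢half))) ⟩
        + p *ℤ Σℤ (σ f) D +ℤ Σℤ (σ F) D
          ≡⟨ cong (+ p *ℤ Σℤ (σ f) D +ℤ_) (Σℤ-cong∈ D (λ d∈D → signed-cong (F-on-D d∈D))) ⟩
        + p *ℤ Σℤ (σ f) D +ℤ Σℤ (σ s) D
          ≡⟨ to (cond2-eq⇔ (+ p) f s D) eq ⟩
        0ℤ ∎

  cond1⇔cond2 : HalfZumkeller (n * p) ⇔ Cond2 n p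
  cond1⇔cond2 = mk⇔ i⇒ii ii⇒i

mainTheorem17 : (n p : ℕ) → 2 ∣ n → Prime p → gcd n p ≡ 1 →
    (HalfZumkeller (n * p) ⇔ Cond2 n p) × (Cond2 n p ⇔ Cond3 n p) × (Cond3 n p ⇔ Cond4 n p)
mainTheorem17 n p 2∣n p-prime gcd≡1 = cond1⇔cond2 , cond2⇔cond3 n p , cond3⇔cond4 n p
  where
  instance
    n≢0 : NonZero n
    n≢0 = coprime⇒nonZero n p-prime gcd≡1
    p≢0 : NonZero p
    p≢0 = prime⇒nonZero p-prime
  open FirstEquivalence p-prime gcd≡1 2∣n
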